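{- Let $m\ge 1$ and let $G$ be a bipartite graph with parts $A$ and $B$, $|A|=|B|=2m+1$, and minimum degree at least $m$. If there is a set $A_1\subseteq A$ with $|N(A_1)|<|A_1|$, then there are partitions $A=A_1'\cup A_2'$ and $B=B_1\cup B_2$ with $|A_1'|=|B_2|=m+1$ and $|A_2'|=|B_1|=m$ such that $G[A_1',B_1]$ and $G[A_2',B_2]$ are complete bipartite (each isomorphic to $K_{m,m+1}$) and $G[A_1',B_2]$ has no edges.
   Context: $N(S)$ denotes the set of vertices adjacent to some vertex of $S$; $G[X,Y]$ denotes the bipartite subgraph of $G$ consisting of the vertices $X\cup Y$ and the edges of $G$ between $X$ and $Y$. -}

module Defs where

open import Data.Nat using (ℕ; suc; _+_; _*_)
open import Data.Bool using (Bool; true; false; _∧_; _∨_)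
open import Data.Fin using (Fin)
open import Data.Fin.Subset using (Subset; inside; outside)
open import Data.Vec using (Vec; tabulate; lookup)
open import Data.List using (List; filter; length)
open import Data.Bool.ListAction using (any)
open import Data.Product using (_×_)
open import Data.Nat using (_≤_)
open import Data.Fin using () renaming (_≟_ to _≟F_)
open import Data.Bool using (T)
open import Data.Bool.Properties using (T?)
open import Data.List.Base using (allFin)

-- A bipartite graph with parts A = Fin n and B = Fin n, given by its
-- biadjacency matrix: adj a b ≡ true iff a ∈ A is adjacent to b ∈ B.
BipGraph : ℕ → Set
BipGraph n = Fin n → Fin n → Bool

degA : ∀ {n} → BipGraph n → Fin n → ℕ
degA {n} G a = length (filter (λ b → T? (G a b)) (allFin n))

degB : ∀ {n} → BipGraph n → Fin n → ℕ
degB {n} G b = length (filter (λ a → T? (G a b)) (allFin n))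

MinDegreeAtLeast : ∀ {n} → BipGraph n → ℕ → Set
MinDegreeAtLeast {n} G d = (∀ a → d ≤ degA G a) × (∀ b → d ≤ degB G b)

isIn : ∀ {n} → Subset n → Fin n → Bool
isIn S i with lookup S i
... | inside  = true
... | outside = false

N : ∀ {n} → BipGraph n → Subset n → Subset n
N {n} G S = tabulate λ b → any (λ a → isIn S a ∧ G a b) (allFin n)

{-# OPTIONS --safe #-}

-- Take A₁′ := A₁ and B₁ := N(A₁). A vertex of A₁ has all its ≥ m neighbours in N(A₁), and a
-- vertex of B outside N(A₁) has all its ≥ m neighbours outside A₁; so m ≤ |N(A₁)| < |A₁| and
-- m ≤ |A ∖ A₁|, which together with |A| = 2m+1 force |A₁| = m+1 and |N(A₁)| = |A ∖ A₁| = m.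
-- Each of those neighbourhoods is then a subset of size ≥ m of a set of size m, hence all of it,
-- which gives the two complete parts; the empty part is the definition of N(A₁).

module Submission where

open import Defs
open import Data.Nat using (ℕ; suc; _+_; _*_; _≤_; _<_; z≤n; s≤s)
open import Data.Nat.Properties
open import Data.Bool using (Bool; true; false)
open import Data.Bool.Properties using (T?; T-≡; T-∧)
open import Data.Fin using (Fin; zero; suc)
open import Data.Fin.Subset using (Subset; _∈_; _⊆_; ∣_∣; ∁; Nonempty)
open import Data.Fin.Subset.Properties
  using (_∈?_; nonempty?; Empty-unique; ∣⊥∣≡0; ∣p∣≤n; ∣∁p∣≡n∸∣p∣; p⊆q⇒∣p∣≤∣q∣; p⊂q⇒∣p∣<∣q∣;
         x∈p⇒x∉∁p; x∉p⇒x∈∁p)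
open import Data.Product using (_×_; ∃-syntax; _,_)
open import Data.Vec using (tabulate)
open import Data.Vec.Properties using (lookup∘tabulate; []=⇒lookup; lookup⇒[]=)
import Data.List as List
open import Data.List using (filter; length; allFin)
open import Data.List.Membership.Propositional using (lose)
open import Data.List.Membership.Propositional.Properties using (∈-allFin)
open import Data.List.Relation.Unary.Any.Properties using (any⁺)
open import Function using (_∘_; Equivalence)
open import Relation.Binary.PropositionalEquality
open import Relation.Nullary using (yes; no; contradiction)

private
  variable
    n : ℕ

∈-tabulate⁺ : {f : Fin n → Bool} {x : Fin n} → f x ≡ true → x ∈ tabulate f
∈-tabulate⁺ {f = f} {x} fx = lookup⇒[]= x _ (trans (lookup∘tabulate f x) fx)

∈-tabulate⁻ : (f : Fin n → Bool) {x : Fin n} → x ∈ tabulate f → f x ≡ true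
∈-tabulate⁻ f {x} x∈ = trans (sym (lookup∘tabulate f x)) ([]=⇒lookup x∈)

length-filter-tabulate : ∀ {k} {A : Set} (P : A → Bool) (f : Fin k → A) →
  length (filter (T? ∘ P) (List.tabulate f)) ≡ ∣ tabulate (P ∘ f) ∣
length-filter-tabulate {0} P f = refl
length-filter-tabulate {suc k} P f with P (f zero)
... | true  = cong suc (length-filter-tabulate P (f ∘ suc))
... | false = length-filter-tabulate P (f ∘ suc)

∣p∣+∣∁p∣≡n : (p : Subset n) → ∣ p ∣ + ∣ ∁ p ∣ ≡ n
∣p∣+∣∁p∣≡n p = trans (cong (∣ p ∣ +_) (∣∁p∣≡n∸∣p∣ p)) (m+[n∸m]≡n (∣p∣≤n p))

∣p∣>0⇒Nonempty : (p : Subset n) → 0 < ∣ p ∣ → Nonempty p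
∣p∣>0⇒Nonempty {n} p ∣p∣>0 with nonempty? p
... | yes ne = ne
... | no ¬ne = contradiction (trans (cong ∣_∣ (Empty-unique ¬ne)) (∣⊥∣≡0 n)) (>⇒≢ ∣p∣>0)

∣p∣<n⇒Nonempty∁ : (p : Subset n) → ∣ p ∣ < n → Nonempty (∁ p)
∣p∣<n⇒Nonempty∁ p ∣p∣<n =
  ∣p∣>0⇒Nonempty (∁ p) (subst (0 <_) (sym (∣∁p∣≡n∸∣p∣ p)) (m<n⇒0<n∸m ∣p∣<n))

p⊆q∧∣q∣≤∣p∣⇒q⊆p : {p q : Subset n} → p ⊆ q → ∣ q ∣ ≤ ∣ p ∣ → q ⊆ p
p⊆q∧∣q∣≤∣p∣⇒q⊆p {p = p} p⊆q ∣q∣≤∣p∣ {x} x∈q with x ∈? p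
... | yes x∈p = x∈p
... | no  x∉p = contradiction (p⊂q⇒∣p∣<∣q∣ (p⊆q , x , x∈q , x∉p)) (≤⇒≯ ∣q∣≤∣p∣)

sizes-forced : ∀ {m x y k k′} → x + y ≡ suc (2 * m) → k + k′ ≡ suc (2 * m) →
  k < x → m ≤ k → m ≤ y → x ≡ suc m × y ≡ m × k ≡ m × k′ ≡ suc m
sizes-forced {m} {x} {y} {k} {k′} x+y≡ k+k′≡ k<x m≤k m≤y = x≡1+m , y≡m , k≡m , k′≡1+m
  where
  2m+1≡1+m+m : suc (2 * m) ≡ suc m + m
  2m+1≡1+m+m = cong (λ z → suc (m + z)) (+-identityʳ m)

  x≡1+m : x ≡ suc m
  x≡1+m = ≤-antisym
    (+-cancelʳ-≤ m x (suc m) (subst (x + m ≤_) (trans x+y≡ 2m+1≡1+m+m) (+-monoʳ-≤ x m≤y)))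
    (≤-trans (s≤s m≤k) k<x)

  y≡m : y ≡ m
  y≡m = +-cancelˡ-≡ (suc m) y m (trans (cong (_+ y) (sym x≡1+m)) (trans x+y≡ 2m+1≡1+m+m))

  k≡m : k ≡ m
  k≡m = ≤-antisym (≤-pred (subst (k <_) x≡1+m k<x)) m≤k

  k′≡1+m : k′ ≡ suc m
  k′≡1+m = +-cancelˡ-≡ m k′ (suc m)
    (trans (cong (_+ k′) (sym k≡m)) (trans k+k′≡ (trans 2m+1≡1+m+m (+-comm (suc m) m))))

isIn-∈ : {S : Subset n} {a : Fin n} → a ∈ S → isIn S a ≡ true
isIn-∈ a∈S rewrite []=⇒lookup a∈S = refl

module _ (G : BipGraph n) where

  nbrA : Fin n → Subset n
  nbrA a = tabulate (G a)

  nbrB : Fin n → Subset n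
  nbrB b = tabulate (λ a → G a b)

  degA≡∣nbrA∣ : ∀ a → degA G a ≡ ∣ nbrA a ∣
  degA≡∣nbrA∣ a = length-filter-tabulate (G a) (λ b → b)

  degB≡∣nbrB∣ : ∀ b → degB G b ≡ ∣ nbrB b ∣
  degB≡∣nbrB∣ b = length-filter-tabulate (λ a → G a b) (λ a → a)

  ∈-N⁺ : {S : Subset n} {a b : Fin n} → a ∈ S → G a b ≡ true → b ∈ N G S
  ∈-N⁺ {S} {a} {b} a∈S Gab = ∈-tabulate⁺ (Equivalence.to T-≡ (any⁺ _
    (lose (∈-allFin a) (Equivalence.from T-∧
      (Equivalence.from T-≡ (isIn-∈ a∈S) , Equivalence.from T-≡ Gab)))))

  nbrA⊆N : (S : Subset n) {a : Fin n} → a ∈ S → nbrA a ⊆ N G S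
  nbrA⊆N S {a} a∈S b∈ = ∈-N⁺ a∈S (∈-tabulate⁻ (G a) b∈)

  nbrB⊆∁ : (S : Subset n) {b : Fin n} → b ∈ ∁ (N G S) → nbrB b ⊆ ∁ S
  nbrB⊆∁ S {b} b∉N {a} a∈ with a ∈? S
  ... | yes a∈S = contradiction b∉N (x∈p⇒x∉∁p (∈-N⁺ a∈S (∈-tabulate⁻ (λ a → G a b) a∈)))
  ... | no  a∉S = x∉p⇒x∈∁p a∉S

lemma16 : (m : ℕ) → 1 ≤ m → (G : BipGraph (suc (2 * m))) →
    MinDegreeAtLeast G m →
    (∃[ A₁ ] ∣ N G A₁ ∣ < ∣ A₁ ∣) →
    ∃[ A₁′ ] ∃[ B₁ ]
      (∣ A₁′ ∣ ≡ suc m) × (∣ ∁ B₁ ∣ ≡ suc m) ×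
      (∣ ∁ A₁′ ∣ ≡ m) × (∣ B₁ ∣ ≡ m) ×
      (∀ a b → a ∈ A₁′ → b ∈ B₁ → G a b ≡ true) ×
      (∀ a b → a ∈ ∁ A₁′ → b ∈ ∁ B₁ → G a b ≡ true) ×
      (∀ a b → a ∈ A₁′ → b ∈ ∁ B₁ → G a b ≡ false)
-- The argument does not use the hypothesis 1 ≤ m.
lemma16 m _ G (δA , δB) (A₁ , ∣K∣<∣A₁∣) =
  let ∣A₁∣≡1+m , ∣∁A₁∣≡m , ∣K∣≡m , ∣∁K∣≡1+m =
        sizes-forced (∣p∣+∣∁p∣≡n A₁) (∣p∣+∣∁p∣≡n K) ∣K∣<∣A₁∣ m≤∣K∣ m≤∣∁A₁∣
  in  A₁ , K , ∣A₁∣≡1+m , ∣∁K∣≡1+m , ∣∁A₁∣≡m , ∣K∣≡m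
    , complete₁ (≤-reflexive ∣K∣≡m) , complete₂ (≤-reflexive ∣∁A₁∣≡m) , empty
  where
  K = N G A₁

  m≤∣nbrA∣ : ∀ a → m ≤ ∣ nbrA G a ∣
  m≤∣nbrA∣ a = subst (m ≤_) (degA≡∣nbrA∣ G a) (δA a)

  m≤∣nbrB∣ : ∀ b → m ≤ ∣ nbrB G b ∣
  m≤∣nbrB∣ b = subst (m ≤_) (degB≡∣nbrB∣ G b) (δB b)

  m≤∣K∣ : m ≤ ∣ K ∣
  m≤∣K∣ with ∣p∣>0⇒Nonempty A₁ (≤-<-trans z≤n ∣K∣<∣A₁∣)
  ... | a , a∈A₁ = ≤-trans (m≤∣nbrA∣ a) (p⊆q⇒∣p∣≤∣q∣ (nbrA⊆N G A₁ a∈A₁))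

  m≤∣∁A₁∣ : m ≤ ∣ ∁ A₁ ∣
  m≤∣∁A₁∣ with ∣p∣<n⇒Nonempty∁ K (<-≤-trans ∣K∣<∣A₁∣ (∣p∣≤n A₁))
  ... | b , b∉K = ≤-trans (m≤∣nbrB∣ b) (p⊆q⇒∣p∣≤∣q∣ (nbrB⊆∁ G A₁ b∉K))

  complete₁ : ∣ K ∣ ≤ m → ∀ a b → a ∈ A₁ → b ∈ K → G a b ≡ true
  complete₁ ∣K∣≤m a b a∈A₁ b∈K = ∈-tabulate⁻ (G a)
    (p⊆q∧∣q∣≤∣p∣⇒q⊆p (nbrA⊆N G A₁ a∈A₁) (≤-trans ∣K∣≤m (m≤∣nbrA∣ a)) b∈K)

  complete₂ : ∣ ∁ A₁ ∣ ≤ m → ∀ a b → a ∈ ∁ A₁ → b ∈ ∁ K → G a b ≡ true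
  complete₂ ∣∁A₁∣≤m a b a∉A₁ b∉K = ∈-tabulate⁻ (λ a → G a b)
    (p⊆q∧∣q∣≤∣p∣⇒q⊆p (nbrB⊆∁ G A₁ b∉K) (≤-trans ∣∁A₁∣≤m (m≤∣nbrB∣ b)) a∉A₁)

  empty : ∀ a b → a ∈ A₁ → b ∈ ∁ K → G a b ≡ false
  empty a b a∈A₁ b∉K with G a b in Gab
  ... | false = refl
  ... | true  = contradiction b∉K (x∈p⇒x∉∁p (∈-N⁺ G a∈A₁ Gab))
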